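{- Let $n,k,a,b$ be integers with $n\geq k\geq 0$ and $a>b>0$. If $-1\leq k-(n+1)b/a\leq 0$, then the sequence $u_j=\binom{n+ja}{k+jb}$, $j=0,1,2,\ldots$, is log-convex, i.e. $u_{j+1}^2\leq u_j u_{j+2}$ for all $j\geq 0$. -}

module Defs where

-- Write n = k + m, a = b + c and B k m = C(k+m, k).  Then u_j = B P_j with
-- P_j = (k + jb, m + jc), and u_{j+1}² ≤ u_j u_{j+2} says that the ratio
-- R(k, m) = B (k + b) (m + c) / B k m does not decrease from P_j to P_{j+1}.
--
-- By absorption, a unit step (k, m) → (k+1, m) multiplies B by (k+m+1)/(k+1)
-- and a step (k, m) → (k, m+1) by (k+m+1)/(m+1).  Comparing these factors at
-- (k, m) and (k+b, m+c), R does not decrease along an up-step when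
-- m b ≤ (k+1) c, nor along a right-step when k c ≤ (m+1) b.  Both hold on the
-- strip -c ≤ k c - m b ≤ b, and a greedy monotone path of admissible steps
-- leads from a point of the strip to any point above and to the right of it,
-- so R is monotone on the strip.  The hypothesis says P_0 lies in the strip,
-- which is invariant under translation by (b, c).  Fractions are handled in
-- cross-multiplied form over ℕ.
module Submission where

open import Defs
open import Data.Nat using (ℕ; suc; _+_; _*_; _^_; _≤_; _<_)
open import Data.Nat.Combinatorics using (_C_)

open import Data.Nat using (zero; _∸_; NonZero; >-nonZero; z≤n; s≤s; _≤?_)
open import Data.Nat.Properties
open import Data.Nat.Combinatorics using (nC1≡n; nCk≡nC[n∸k])
  renaming (nCk+nC[k+1]≡[n+1]C[k+1] to pascal)
open import Data.Nat.Tactic.RingSolver using (solve)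
open import Data.List using ([]; _∷_)
open import Relation.Binary.PropositionalEquality
open import Relation.Nullary using (yes; no)
open import Function using (_$_)
open import Data.Product using (_,_)

absorption : ∀ n k → suc k * (suc n C suc k) ≡ suc n * (n C k)
absorption n zero =
  trans (*-identityˡ (suc n C 1)) (trans (nC1≡n (suc n)) (sym (*-identityʳ (suc n))))
absorption zero (suc k) = *-zeroʳ (suc (suc k))
absorption (suc n) (suc k) = begin
  suc (suc k) * (suc (suc n) C suc (suc k))
    ≡⟨ cong (suc (suc k) *_) (sym (pascal (suc n) (suc k))) ⟩
  suc (suc k) * (c + suc n C suc (suc k))
    ≡⟨ *-distribˡ-+ (suc (suc k)) c _ ⟩
  (c + suc k * c) + suc (suc k) * (suc n C suc (suc k))
    ≡⟨ cong₂ (λ x y → (c + x) + y) (absorption n k) (absorption n (suc k)) ⟩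
  (c + suc n * (n C k)) + suc n * (n C suc k)
    ≡⟨ +-assoc c _ _ ⟩
  c + (suc n * (n C k) + suc n * (n C suc k))
    ≡⟨ cong (c +_) (sym (*-distribˡ-+ (suc n) (n C k) _)) ⟩
  c + suc n * (n C k + n C suc k)
    ≡⟨ cong (λ x → c + suc n * x) (pascal n k) ⟩
  suc (suc n) * c ∎
  where
  open ≡-Reasoning
  c : ℕ
  c = suc n C suc k

C-positive : ∀ {n k} → k ≤ n → 0 < n C k
C-positive {n} {zero} _ = s≤s z≤n
C-positive {suc n} {suc k} (s≤s k≤n) =
  subst (0 <_) (pascal n k) (<-≤-trans (C-positive k≤n) (m≤m+n (n C k) _))

B : ℕ → ℕ → ℕ
B k m = (k + m) C k

B-nonZero : ∀ k m → NonZero (B k m)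
B-nonZero k m = >-nonZero (C-positive (m≤m+n k m))

B-sym : ∀ k m → B k m ≡ B m k
B-sym k m = begin
  (k + m) C k              ≡⟨ nCk≡nC[n∸k] (m≤m+n k m) ⟩
  (k + m) C (k + m ∸ k)    ≡⟨ cong ((k + m) C_) (m+n∸m≡n k m) ⟩
  (k + m) C m              ≡⟨ cong (_C m) (+-comm k m) ⟩
  (m + k) C m              ∎
  where open ≡-Reasoning

B-stepˡ : ∀ k m → suc k * B (suc k) m ≡ suc (k + m) * B k m
B-stepˡ k m = absorption (k + m) k

B-stepʳ : ∀ k m → suc m * B k (suc m) ≡ suc (m + k) * B k m
B-stepʳ k m = begin
  suc m * B k (suc m)      ≡⟨ cong (suc m *_) (B-sym k (suc m)) ⟩
  suc m * B (suc m) k      ≡⟨ B-stepˡ m k ⟩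
  suc (m + k) * B m k      ≡⟨ cong (suc (m + k) *_) (B-sym m k) ⟩
  suc (m + k) * B k m      ∎
  where open ≡-Reasoning

cross-trans : ∀ x₁ y₁ x₂ y₂ x₃ y₃ → .{{_ : NonZero y₂}} →
  x₁ * y₂ ≤ x₂ * y₁ → x₂ * y₃ ≤ x₃ * y₂ → x₁ * y₃ ≤ x₃ * y₁
cross-trans x₁ y₁ x₂ y₂ x₃ y₃ h₁₂ h₂₃ = *-cancelˡ-≤ y₂ (begin
  y₂ * (x₁ * y₃)   ≡⟨ solve (x₁ ∷ y₂ ∷ y₃ ∷ []) ⟩
  (x₁ * y₂) * y₃   ≤⟨ *-monoˡ-≤ y₃ h₁₂ ⟩
  (x₂ * y₁) * y₃   ≡⟨ solve (x₂ ∷ y₁ ∷ y₃ ∷ []) ⟩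
  y₁ * (x₂ * y₃)   ≤⟨ *-monoʳ-≤ y₁ h₂₃ ⟩
  y₁ * (x₃ * y₂)   ≡⟨ solve (y₁ ∷ x₃ ∷ y₂ ∷ []) ⟩
  y₂ * (x₃ * y₁)   ∎)
  where open ≤-Reasoning

ratio-step : ∀ X X' Y Y' p q p' q' → .{{_ : NonZero p}} → .{{_ : NonZero p'}} →
  p * X' ≡ q * X → p' * Y' ≡ q' * Y → q * p' ≤ q' * p → Y * X' ≤ Y' * X
ratio-step X X' Y Y' p q p' q' eX eY q/p≤q'/p' =
  *-cancelˡ-≤ (p * p') {{m*n≢0 p p'}} (begin
    p * p' * (Y * X')   ≡⟨ solve (p ∷ p' ∷ Y ∷ X' ∷ []) ⟩
    p' * Y * (p * X')   ≡⟨ cong (p' * Y *_) eX ⟩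
    p' * Y * (q * X)    ≡⟨ solve (p' ∷ Y ∷ q ∷ X ∷ []) ⟩
    q * p' * (Y * X)    ≤⟨ *-monoˡ-≤ (Y * X) q/p≤q'/p' ⟩
    q' * p * (Y * X)    ≡⟨ solve (q' ∷ p ∷ Y ∷ X ∷ []) ⟩
    p * (q' * Y) * X    ≡⟨ cong (λ z → p * z * X) (sym eY) ⟩
    p * (p' * Y') * X   ≡⟨ solve (p ∷ p' ∷ Y' ∷ X ∷ []) ⟩
    p * p' * (Y' * X)   ∎)
  where open ≤-Reasoning

step-factor-≤ : ∀ x y s t → y * s ≤ suc x * t →
  suc (x + y) * suc (x + s) ≤ suc (x + s + (y + t)) * suc x
step-factor-≤ x y s t ys≤[x+1]t = begin
  suc (x + y) * suc (x + s)           ≡⟨ solve (x ∷ y ∷ s ∷ []) ⟩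
  suc (x + y) * suc x + s * suc x + y * s
    ≤⟨ +-monoʳ-≤ (suc (x + y) * suc x + s * suc x) ys≤[x+1]t ⟩
  suc (x + y) * suc x + s * suc x + suc x * t
    ≡⟨ solve (x ∷ y ∷ s ∷ t ∷ []) ⟩
  suc (x + s + (y + t)) * suc x       ∎
  where open ≤-Reasoning

module Shift (b c : ℕ) where

  -- R(k, m) ≤ R(k', m'), where R(k, m) = B (k + b) (m + c) / B k m.
  record Ratio≤ (k m k' m' : ℕ) : Set where
    constructor cross
    field
      cross-≤ : B (k + b) (m + c) * B k' m' ≤ B (k' + b) (m' + c) * B k m

  ratio-refl : ∀ k m → Ratio≤ k m k m
  ratio-refl k m = cross ≤-refl

  ratio-trans : ∀ {k m k' m' k″ m″} →
    Ratio≤ k m k' m' → Ratio≤ k' m' k″ m″ → Ratio≤ k m k″ m″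
  ratio-trans {k} {m} {k'} {m'} {k″} {m″} (cross h₁) (cross h₂) =
    cross (cross-trans (B (k + b) (m + c)) (B k m) (B (k' + b) (m' + c)) (B k' m')
                       (B (k″ + b) (m″ + c)) (B k″ m″) {{B-nonZero k' m'}} h₁ h₂)

  UpOK : ℕ → ℕ → Set
  UpOK k m = m * b ≤ suc k * c

  RightOK : ℕ → ℕ → Set
  RightOK k m = k * c ≤ suc m * b

  up-ok-persists : ∀ k m → UpOK k m → UpOK (suc k) m
  up-ok-persists k m ok = ≤-trans ok (*-monoˡ-≤ c (n≤1+n (suc k)))

  right-ok-persists : ∀ k m → RightOK k m → RightOK k (suc m)
  right-ok-persists k m ok = ≤-trans ok (*-monoˡ-≤ b (n≤1+n (suc m)))

  -- An admissible unit step does not decrease R: compare the growth factors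
  -- of B at (k, m) and at (k + b, m + c).
  up-step : ∀ k m → UpOK k m → Ratio≤ k m (suc k) m
  up-step k m ok = cross $
    ratio-step (B k m) (B (suc k) m) (B (k + b) (m + c)) (B (suc k + b) (m + c))
      (suc k) (suc (k + m)) (suc (k + b)) (suc (k + b + (m + c)))
      (B-stepˡ k m) (B-stepˡ (k + b) (m + c)) (step-factor-≤ k m b c ok)

  right-step : ∀ k m → RightOK k m → Ratio≤ k m k (suc m)
  right-step k m ok = cross $
    ratio-step (B k m) (B k (suc m)) (B (k + b) (m + c)) (B (k + b) (suc m + c))
      (suc m) (suc (m + k)) (suc (m + c)) (suc (m + c + (k + b)))
      (B-stepʳ k m) (B-stepʳ (k + b) (m + c)) (step-factor-≤ m k c b ok)

  upwards : ∀ u {k m} → UpOK k m → Ratio≤ k m (k + u) m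
  upwards zero {k} {m} _ =
    subst (λ k' → Ratio≤ k m k' m) (sym (+-identityʳ k)) (ratio-refl k m)
  upwards (suc u) {k} {m} ok =
    subst (λ k' → Ratio≤ k m k' m) (sym (+-suc k u))
      (ratio-trans (up-step k m ok) (upwards u (up-ok-persists k m ok)))

  rightwards : ∀ r {k m} → RightOK k m → Ratio≤ k m k (m + r)
  rightwards zero {k} {m} _ =
    subst (λ m' → Ratio≤ k m k m') (sym (+-identityʳ m)) (ratio-refl k m)
  rightwards (suc r) {k} {m} ok =
    subst (λ m' → Ratio≤ k m k m') (sym (+-suc m r))
      (ratio-trans (right-step k m ok) (rightwards r (right-ok-persists k m ok)))

  record InStrip (k m : ℕ) : Set where
    constructor _,_
    field
      right-ok : RightOK k m
      up-ok    : UpOK k m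

  -- R is monotone on the strip: the greedy path goes up while that keeps it
  -- inside the strip and right otherwise, and the strip is never left.
  ratio-monotone : ∀ u r {k m} → InStrip k m → Ratio≤ k m (k + u) (m + r)
  ratio-monotone u zero {k} {m} (_ , up-ok) =
    subst (λ m' → Ratio≤ k m (k + u) m') (sym (+-identityʳ m)) (upwards u up-ok)
  ratio-monotone zero r {k} {m} (right-ok , _) =
    subst (λ k' → Ratio≤ k m k' (m + r)) (sym (+-identityʳ k)) (rightwards r right-ok)
  ratio-monotone (suc u) (suc r) {k} {m} (right-ok , up-ok) with suc k * c ≤? suc m * b
  ... | yes right-ok′ =
    subst (λ k' → Ratio≤ k m k' (m + suc r)) (sym (+-suc k u))
      (ratio-trans (up-step k m up-ok)
        (ratio-monotone u (suc r) (right-ok′ , up-ok-persists k m up-ok)))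
  ... | no ¬right-ok′ =
    subst (λ m' → Ratio≤ k m (k + suc u) m') (sym (+-suc m r))
      (ratio-trans (right-step k m right-ok)
        (ratio-monotone (suc u) r
          (right-ok-persists k m right-ok , <⇒≤ (≰⇒> ¬right-ok′))))

  -- Translating by (b, c) preserves  k c - m b,  hence the strip.
  strip-shift : ∀ {k m} → InStrip k m → InStrip (k + b) (m + c)
  strip-shift {k} {m} (right-ok , up-ok) = right-ok′ , up-ok′
    where
    open ≤-Reasoning
    right-ok′ : RightOK (k + b) (m + c)
    right-ok′ = begin
      (k + b) * c             ≡⟨ solve (k ∷ b ∷ c ∷ []) ⟩
      k * c + b * c           ≤⟨ +-monoˡ-≤ (b * c) right-ok ⟩
      suc m * b + b * c       ≡⟨ solve (m ∷ b ∷ c ∷ []) ⟩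
      suc (m + c) * b         ∎
    up-ok′ : UpOK (k + b) (m + c)
    up-ok′ = begin
      (m + c) * b             ≡⟨ solve (m ∷ c ∷ b ∷ []) ⟩
      m * b + b * c           ≤⟨ +-monoˡ-≤ (b * c) up-ok ⟩
      suc k * c + b * c       ≡⟨ solve (k ∷ b ∷ c ∷ []) ⟩
      suc (k + b) * c         ∎

  strip-from-bounds : ∀ k m → k * (b + c) ≤ (k + m + 1) * b →
    (k + m + 1) * b ≤ k * (b + c) + (b + c) → InStrip k m
  strip-from-bounds k m lower upper =
    +-cancelˡ-≤ (k * b) _ _ right-ok , +-cancelˡ-≤ (k * b + b) _ _ up-ok
    where
    open ≤-Reasoning
    right-ok : k * b + k * c ≤ k * b + suc m * b
    right-ok = begin
      k * b + k * c           ≡⟨ solve (k ∷ b ∷ c ∷ []) ⟩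
      k * (b + c)             ≤⟨ lower ⟩
      (k + m + 1) * b         ≡⟨ solve (k ∷ m ∷ b ∷ []) ⟩
      k * b + suc m * b       ∎
    up-ok : k * b + b + m * b ≤ k * b + b + suc k * c
    up-ok = begin
      k * b + b + m * b       ≡⟨ solve (k ∷ m ∷ b ∷ []) ⟩
      (k + m + 1) * b         ≤⟨ upper ⟩
      k * (b + c) + (b + c)   ≡⟨ solve (k ∷ b ∷ c ∷ []) ⟩
      k * b + b + suc k * c   ∎

  -- Log-convexity at one point of the strip: R(K, M) ≤ R(K + b, M + c).
  log-convex-at : ∀ {K M} → InStrip K M →
    B (K + b) (M + c) ^ 2 ≤ B K M * B (K + b + b) (M + c + c)
  log-convex-at {K} {M} in-strip =
    subst₂ _≤_ (cong (Y *_) (sym (*-identityʳ Y)))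
               (*-comm (B (K + b + b) (M + c + c)) (B K M))
      (Ratio≤.cross-≤ (ratio-monotone b c in-strip))
    where
    Y : ℕ
    Y = B (K + b) (M + c)

  u : ℕ → ℕ → ℕ → ℕ
  u k m j = B (k + j * b) (m + j * c)

  along : ∀ x s j → x + suc j * s ≡ x + j * s + s
  along x s j = solve (x ∷ s ∷ j ∷ [])

  strip-along : ∀ {k m} → InStrip k m → ∀ j → InStrip (k + j * b) (m + j * c)
  strip-along {k} {m} in-strip zero =
    subst₂ InStrip (sym (+-identityʳ k)) (sym (+-identityʳ m)) in-strip
  strip-along {k} {m} in-strip (suc j) =
    subst₂ InStrip (sym (along k b j)) (sym (along m c j)) (strip-shift (strip-along in-strip j))

  u-log-convex : ∀ {k m} → InStrip k m → ∀ j →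
    u k m (suc j) ^ 2 ≤ u k m j * u k m (suc (suc j))
  u-log-convex {k} {m} in-strip j =
    subst₂ _≤_ (cong (_^ 2) (sym u₁)) (cong (u k m j *_) (sym u₂))
      (log-convex-at (strip-along in-strip j))
    where
    u₁ : u k m (suc j) ≡ B (k + j * b + b) (m + j * c + c)
    u₁ = cong₂ B (along k b j) (along m c j)
    u₂ : u k m (suc (suc j)) ≡ B (k + j * b + b + b) (m + j * c + c + c)
    u₂ = cong₂ B (trans (along k b (suc j)) (cong (_+ b) (along k b j)))
                 (trans (along m c (suc j)) (cong (_+ c) (along m c j)))

theorem1 : (n k a b : ℕ) → k ≤ n → 0 < b → b < a →
    k * a ≤ (n + 1) * b → (n + 1) * b ≤ k * a + a →
    (j : ℕ) →
    ((n + suc j * a) C (k + suc j * b)) ^ 2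
      ≤ ((n + j * a) C (k + j * b)) * ((n + suc (suc j) * a) C (k + suc (suc j) * b))
theorem1 n k a b k≤n _ b<a lower upper j
  with m , refl ← m≤n⇒∃[o]m+o≡n k≤n
     | c , refl ← m≤n⇒∃[o]m+o≡n (<⇒≤ b<a) =
  subst₂ _≤_ (cong (_^ 2) (u≡C (suc j))) (cong₂ _*_ (u≡C j) (u≡C (suc (suc j))))
    (u-log-convex (strip-from-bounds k m lower upper) j)
  where
  open Shift b c
  u≡C : ∀ i → u k m i ≡ (k + m + i * (b + c)) C (k + i * b)
  u≡C i = cong (_C (k + i * b)) (solve (k ∷ m ∷ b ∷ c ∷ i ∷ []))
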